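{- For every face $F$ of $\mathcal{P}_\lambda$, every edge of $\phi(F)$ can be extended to a positive path of $\Gamma_{\mathbf{k}}$ lying in $\phi(F)$.
   Context: Fix $n>1$, a sequence $\mathbf{k}=(k_1,\dots,k_s)$ of positive integers with $\sum k_i=n$, $n_i=k_1+\dots+k_i$, $n_0=0$, and real $\lambda=(\lambda_1,\dots,\lambda_n)$ with $\lambda_1=\cdots=\lambda_{n_1}>\lambda_{n_1+1}=\cdots=\lambda_{n_2}>\cdots>\lambda_{n_{s-1}+1}=\cdots=\lambda_n$. Let $I=\{(i,j)\in\mathbb{Z}^2:i,j\ge1,\ i+j\le n\}$. $\mathcal{P}_\lambda\subset\mathbb{R}^I$ is the set of $x=(x_{i,j})$ with $x_{i,j+1}\ge x_{i,j}\ge x_{i+1,j}$ for all $(i,j)\in I$, where $x_{i,n+1-i}:=\lambda_i$. Faces of $\mathcal{P}_\lambda$ are its nonempty faces. $Q^+$ is the directed graph on $\mathbb{Z}_{\ge0}^2$ with edges $((i,j),(i,j+1))$, $((i,j),(i+1,j))$. The terminal vertices are $T_{\mathbf{k}}=\{(n_i,n-n_i):0\le i\le s\}$, $\Gamma_{\mathbf{k}}$ is the induced subgraph of $Q^+$ on $\{(a,b):a\le c,\ b\le d\text{ for some }(c,d)\in T_{\mathbf{k}}\}$, and a positive path is a shortest directed path in $\Gamma_{\mathbf{k}}$ from the origin $(0,0)$ to a terminal vertex. For a face $F$, $\phi(F)$ is the subgraph of $Q^+$ whose edge set consists of: $((0,i),(0,i+1))$ and $((i,0),(i+1,0))$ for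 $0\le i\le n-1$; $((i-1,j),(i,j))$ for each $(i,j)\in I$ such that some point of $F$ has $x_{i,j}<x_{i,j+1}$; $((i,j-1),(i,j))$ for each $(i,j)\in I$ such that some point of $F$ has $x_{i,j}>x_{i+1,j}$; and whose vertex set is the set of endpoints of these edges. -}

module Defs where

open import Level using (0ℓ)
open import Data.Nat as ℕ using (ℕ; zero; suc; _∸_)
open import Data.Product using (Σ; ∃; _×_; _,_; proj₁; proj₂)
open import Data.Sum using (_⊎_)
open import Data.Empty using (⊥)
open import Data.List using (List; []; _∷_; length; map; scanl)
open import Data.List.Membership.Propositional using (_∈_)
open import Relation.Binary.PropositionalEquality using (_≡_; _≢_)
open import Relation.Nullary using (¬_)
open import Algebra.Structures using (IsCommutativeRing)
open import Relation.Binary.Structures using (IsTotalOrder)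

-- Ordered fields (the paper works over ℝ; we work over an arbitrary
-- ordered field, of which ℝ is an instance).

record OrderedField : Set₁ where
  infixl 6 _+_
  infixl 7 _*_
  infix 4 _≤_ _<_
  field
    Carrier : Set
    _+_ _*_ : Carrier → Carrier → Carrier
    -_      : Carrier → Carrier
    0# 1#   : Carrier
    _≤_     : Carrier → Carrier → Set
    isCommutativeRing : IsCommutativeRing _≡_ _+_ _*_ -_ 0# 1#
    isTotalOrder      : IsTotalOrder _≡_ _≤_
    0≢1     : 0# ≢ 1#
    inverse : ∀ x → x ≢ 0# → Σ Carrier (λ y → x * y ≡ 1#)
    +-monoˡ : ∀ {x y} z → x ≤ y → x + z ≤ y + z
    *-nonneg : ∀ {x y} → 0# ≤ x → 0# ≤ y → 0# ≤ x * y

  _<_ : Carrier → Carrier → Set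
  x < y = (x ≤ y) × (x ≢ y)

Vertex : Set
Vertex = ℕ × ℕ

partialSums : List ℕ → List ℕ
partialSums k = scanl ℕ._+_ 0 k

Terminal : ℕ → List ℕ → Vertex → Set
Terminal n k (a , b) = Σ ℕ λ m → (m ∈ partialSums k) × (a ≡ m) × (b ≡ n ∸ m)

QEdge : Vertex → Vertex → Set
QEdge (a , b) (c , d) = ((c ≡ a) × (d ≡ suc b)) ⊎ ((c ≡ suc a) × (d ≡ b))

ΓVertex : ℕ → List ℕ → Vertex → Set
ΓVertex n k (a , b) = Σ Vertex λ t → Terminal n k t × (a ℕ.≤ proj₁ t) × (b ℕ.≤ proj₂ t)

ΓEdge : ℕ → List ℕ → Vertex → Vertex → Set
ΓEdge n k u v = QEdge u v × ΓVertex n k u × ΓVertex n k v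

steps : {A : Set} → List A → List (A × A)
steps (a ∷ b ∷ rest) = (a , b) ∷ steps (b ∷ rest)
steps _ = []

lastOr : {A : Set} → A → List A → A
lastOr d [] = d
lastOr d (a ∷ rest) = lastOr a rest

IsPath : (Vertex → Vertex → Set) → Vertex → Vertex → List Vertex → Set
IsPath E u v [] = ⊥
IsPath E u v (w ∷ ws) =
  (w ≡ u) × (lastOr w ws ≡ v) × (∀ {e} → e ∈ steps (w ∷ ws) → E (proj₁ e) (proj₂ e))

pathLength : List Vertex → ℕ
pathLength vs = length (steps vs)

origin : Vertex
origin = (0 , 0)

IsPositivePath : ℕ → List ℕ → List Vertex → Set
IsPositivePath n k vs = Σ Vertex λ t →
  Terminal n k t × IsPath (ΓEdge n k) origin t vs ×
  (∀ ws → IsPath (ΓEdge n k) origin t ws → pathLength vs ℕ.≤ pathLength ws)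

module GT (K : OrderedField) where
  open OrderedField K

  -- λ is 1-indexed (λ i for 1 ≤ i ≤ n); shape condition w.r.t. k:
  -- λ_m > λ_{m+1} if m is one of n_1..n_{s-1}, λ_m = λ_{m+1} otherwise
  LambdaShape : ℕ → List ℕ → (ℕ → Carrier) → Set
  LambdaShape n k lam =
    (∀ m → 1 ℕ.≤ m → m ℕ.< n → m ∈ partialSums k → lam (suc m) < lam m) ×
    (∀ m → 1 ℕ.≤ m → m ℕ.< n → ¬ (m ∈ partialSums k) → lam m ≡ lam (suc m))

  -- points of ℝ^I are represented by functions ℕ → ℕ → K; only the
  -- values on I = {(i,j) : i,j ≥ 1, i+j ≤ n} matter for everything below.
  Point : Set
  Point = ℕ → ℕ → Carrier

  ext : ℕ → (ℕ → Carrier) → Point → Point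
  ext n lam x i j with (i ℕ.+ j) ℕ.≟ suc n
  ... | Relation.Nullary.yes _ = lam i
  ... | Relation.Nullary.no _  = x i j

  InI : ℕ → ℕ → ℕ → Set
  InI n i j = (1 ℕ.≤ i) × (1 ℕ.≤ j) × (i ℕ.+ j ℕ.≤ n)

  InP : ℕ → (ℕ → Carrier) → Point → Set
  InP n lam x = ∀ i j → InI n i j →
    (x i j ≤ ext n lam x i (suc j)) × (ext n lam x (suc i) j ≤ x i j)

  sumTo : ℕ → (ℕ → Carrier) → Carrier
  sumTo zero f = 0#
  sumTo (suc m) f = sumTo m f + f (suc m)

  pairing : ℕ → Point → Point → Carrier
  pairing n c x = sumTo n (λ i → sumTo (n ∸ i) (λ j → c i j * x i j))

  -- the face of P_λ cut out by maximising the linear functional c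
  -- (c = 0 gives P_λ itself); it is a (nonempty) face iff it has a point
  InFace : ℕ → (ℕ → Carrier) → Point → Point → Set
  InFace n lam c x = InP n lam x × (∀ y → InP n lam y → pairing n c y ≤ pairing n c x)

  PhiEdge : ℕ → (ℕ → Carrier) → Point → Vertex → Vertex → Set
  PhiEdge n lam c u v =
    (Σ ℕ λ i → (i ℕ.< n) × (u ≡ (0 , i)) × (v ≡ (0 , suc i))) ⊎
    (Σ ℕ λ i → (i ℕ.< n) × (u ≡ (i , 0)) × (v ≡ (suc i , 0))) ⊎
    (Σ ℕ λ i → Σ ℕ λ j → InI n i j × (u ≡ (i ∸ 1 , j)) × (v ≡ (i , j)) ×
       Σ Point λ x → InFace n lam c x × (x i j < ext n lam x i (suc j))) ⊎
    (Σ ℕ λ i → Σ ℕ λ j → InI n i j × (u ≡ (i , j ∸ 1)) × (v ≡ (i , j)) ×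
       Σ Point λ x → InFace n lam c x × (ext n lam x (suc i) j < x i j))

  PhiVertex : ℕ → (ℕ → Carrier) → Point → Vertex → Set
  PhiVertex n lam c w = Σ Vertex λ w' →
    PhiEdge n lam c w w' ⊎ PhiEdge n lam c w' w

  LiesIn : ℕ → (ℕ → Carrier) → Point → List Vertex → Set
  LiesIn n lam c vs =
    (∀ {w} → w ∈ vs → PhiVertex n lam c w) ×
    (∀ {e} → e ∈ steps vs → PhiEdge n lam c (proj₁ e) (proj₂ e))

-- Fix a point x of the face F and call a vertex (a , b) of the triangle gapped when
-- x_{a+1,b} < x_{a,b+1} (vertices on the two axes always count as gapped).  By the
-- interlacing inequalities x_{a+1,b} ≤ x_{a,b} ≤ x_{a,b+1}, one of the two inequalities
-- is strict, which is an edge of φ(F) entering (a , b) from a gapped vertex; iterating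
-- gives a path of φ(F) from the origin.  Likewise x_{a+1,b} ≤ x_{a+1,b+1} ≤ x_{a,b+1}
-- gives an edge of φ(F) leaving (a , b) towards a gapped vertex, until the antidiagonal
-- a + b = n is reached, where the gap reads λ_{a+1} < λ_a, so a is some n_i.  A gapped
-- vertex lies in Γ_k: were there no n_i in [a , n - b], then λ would be constant there,
-- and the row through x_{a,b+1} and the column through x_{a+1,b} would force
-- x_{a,b+1} ≤ λ_a = λ_{n-b+1} ≤ x_{a+1,b}.  Both endpoints of an edge of φ(F) are gapped
-- (at the point witnessing the edge), and every monotone path from the origin to a
-- terminal vertex has the same length, so the concatenation is a positive path.
module Submission where

open import Defs
open import Data.Nat using (ℕ; _<_)
open import Data.Product using (Σ; _×_; _,_)
open import Data.List using (List)
open import Data.Nat.ListAction using (sum)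
open import Data.List.Relation.Unary.All using (All)
open import Data.List.Membership.Propositional using (_∈_)
open import Relation.Binary.PropositionalEquality using (_≡_)

open import Data.Nat using (zero; suc; _+_; _∸_; _≤_; z≤n; s≤s; _≟_)
import Data.Nat.Properties as ℕₚ
open import Algebra.Properties.CommutativeSemigroup ℕₚ.+-commutativeSemigroup using (xy∙z≈xz∙y)
open import Data.Product using (proj₁; proj₂)
open import Data.Sum using (_⊎_; inj₁; inj₂; [_,_]′)
import Data.Sum as Sum
open import Data.Empty using (⊥-elim)
open import Data.List using ([]; _∷_; scanl)
open import Data.List.Relation.Unary.Any using (here; there)
open import Data.List.Membership.DecPropositional _≟_ using (_∈?_)
open import Relation.Binary.PropositionalEquality
  using (refl; sym; trans; cong; cong₂; subst; subst₂; module ≡-Reasoning)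
open import Relation.Binary.Construct.Closure.ReflexiveTransitive using (Star; ε; _◅_; _◅◅_)
open import Relation.Nullary using (yes; no)
open import Algebra.Structures using (IsCommutativeRing)
open import Relation.Binary.Structures using (IsTotalOrder)
open import Relation.Binary.Bundles using (Poset)
import Relation.Binary.Reasoning.PartialOrder as PosetReasoning

module OrderedFieldProperties (K : OrderedField) where
  open OrderedField K renaming (_≤_ to _≤ᴷ_; _<_ to _<ᴷ_; _+_ to _+ᴷ_)
  open IsTotalOrder isTotalOrder using (antisym; total; isPartialOrder)
  open IsCommutativeRing isCommutativeRing using (+-assoc; +-comm; -‿inverseʳ; +-identityʳ)

  poset : Poset _ _ _
  poset = record { Carrier = Carrier ; _≈_ = _≡_ ; _≤_ = _≤ᴷ_ ; isPartialOrder = isPartialOrder }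

  +-cancelʳ-≤ : ∀ z {a b} → a +ᴷ z ≤ᴷ b +ᴷ z → a ≤ᴷ b
  +-cancelʳ-≤ z {a} {b} le = subst₂ _≤ᴷ_ (y+z-z≡y a) (y+z-z≡y b) (+-monoˡ (- z) le)
    where
    open ≡-Reasoning
    y+z-z≡y : ∀ y → y +ᴷ z +ᴷ - z ≡ y
    y+z-z≡y y = begin
      y +ᴷ z +ᴷ - z   ≡⟨ +-assoc y z (- z) ⟩
      y +ᴷ (z +ᴷ - z) ≡⟨ cong (y +ᴷ_) (-‿inverseʳ z) ⟩
      y +ᴷ 0#         ≡⟨ +-identityʳ y ⟩
      y               ∎

  -- Equality is not decidable, so the case split comes from comparing b + b with a + d.
  ≤-≤-split : ∀ {a b d} → a ≤ᴷ b → b ≤ᴷ d → a <ᴷ d → a <ᴷ b ⊎ b <ᴷ d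
  ≤-≤-split {a} {b} {d} a≤b b≤d (_ , a≢d) with total (b +ᴷ b) (a +ᴷ d)
  ... | inj₁ b+b≤a+d = inj₂ (b≤d , λ { refl → a≢d (antisym a≤b (+-cancelʳ-≤ b b+b≤a+d)) })
  ... | inj₂ a+d≤b+b = inj₁ (a≤b , λ { refl →
          a≢d (antisym b≤d (+-cancelʳ-≤ a (subst (_≤ᴷ a +ᴷ a) (+-comm a d) a+d≤b+b))) })

module _ {A : Set} {R : A → A → Set} where
  targets : ∀ {u w} → Star R u w → List A
  targets ε                 = []
  targets (_◅_ {j = v} _ p) = v ∷ targets p

  vertices : ∀ {u w} → Star R u w → List A
  vertices {u} p = u ∷ targets p

  Incident : A → Set
  Incident z = Σ A λ y → R z y ⊎ R y z

  lastOr-targets : ∀ {u w} (p : Star R u w) → lastOr u (targets p) ≡ w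
  lastOr-targets ε       = refl
  lastOr-targets (_ ◅ p) = lastOr-targets p

  steps-vertices⁻ : ∀ {u w} (p : Star R u w) {e} → e ∈ steps (vertices p) → R (proj₁ e) (proj₂ e)
  steps-vertices⁻ ε ()
  steps-vertices⁻ (g ◅ p) (here refl) = g
  steps-vertices⁻ (g ◅ p) (there m)   = steps-vertices⁻ p m

  ∈-steps-◅◅ : ∀ {a u v w} (p : Star R a u) (g : R u v) (q : Star R v w) →
               (u , v) ∈ steps (vertices (p ◅◅ g ◅ q))
  ∈-steps-◅◅ ε       g q = here refl
  ∈-steps-◅◅ (_ ◅ p) g q = there (∈-steps-◅◅ p g q)

  ∈-vertices-◅⇒incident : ∀ {u v w z} (g : R u v) (q : Star R v w) →
                           z ∈ vertices (g ◅ q) → Incident z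
  ∈-vertices-◅⇒incident g q       (here refl)         = _ , inj₁ g
  ∈-vertices-◅⇒incident g ε       (there (here refl)) = _ , inj₂ g
  ∈-vertices-◅⇒incident g (h ◅ q) (there m)           = ∈-vertices-◅⇒incident h q m

  ∈-vertices-◅◅⇒incident : ∀ {a u v w z} (p : Star R a u) (g : R u v) (q : Star R v w) →
                            z ∈ vertices (p ◅◅ g ◅ q) → Incident z
  ∈-vertices-◅◅⇒incident ε       g q = ∈-vertices-◅⇒incident g q
  ∈-vertices-◅◅⇒incident (h ◅ p) g q = ∈-vertices-◅⇒incident h (p ◅◅ g ◅ q)

Star⇒IsPath : ∀ {R E : Vertex → Vertex → Set} {u v} →
              (∀ {a b} → R a b → E a b) → (p : Star R u v) → IsPath E u v (vertices p)
Star⇒IsPath R⇒E p = refl , lastOr-targets p , λ m → R⇒E (steps-vertices⁻ p m)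

rank : Vertex → ℕ
rank (a , b) = a + b

QEdge-rank : ∀ {u v} → QEdge u v → rank v ≡ suc (rank u)
QEdge-rank {a , b} (inj₁ (refl , refl)) = ℕₚ.+-suc a b
QEdge-rank         (inj₂ (refl , refl)) = refl

module _ {E : Vertex → Vertex → Set} (E⇒Q : ∀ {a b} → E a b → QEdge a b) where
  IsPath-length : ∀ {u v} ws → IsPath E u v ws → pathLength ws + rank u ≡ rank v
  IsPath-length (w ∷ ws) (refl , refl , edges) = go w ws edges
    where
    open ≡-Reasoning
    go : ∀ w ws → (∀ {e} → e ∈ steps (w ∷ ws) → E (proj₁ e) (proj₂ e)) →
         pathLength (w ∷ ws) + rank w ≡ rank (lastOr w ws)
    go w []        _     = refl
    go w (w′ ∷ ws) edges = begin
      suc (pathLength (w′ ∷ ws)) + rank w ≡⟨ ℕₚ.+-suc _ (rank w) ⟨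
      pathLength (w′ ∷ ws) + suc (rank w) ≡⟨ cong (pathLength (w′ ∷ ws) +_) w→w′-rank ⟨
      pathLength (w′ ∷ ws) + rank w′      ≡⟨ go w′ ws (λ m → edges (there m)) ⟩
      rank (lastOr w′ ws)                 ∎
      where w→w′-rank = QEdge-rank (E⇒Q (edges (here refl)))

  IsPath-shortest : ∀ {u v} vs ws → IsPath E u v vs → IsPath E u v ws →
                    pathLength vs ≤ pathLength ws
  IsPath-shortest vs ws p q = ℕₚ.≤-reflexive
    (ℕₚ.+-cancelʳ-≡ _ _ _ (trans (IsPath-length vs p) (sym (IsPath-length ws q))))

Star⇒IsPositivePath : ∀ {n k} {R : Vertex → Vertex → Set} {t} →
                      (∀ {a b} → R a b → ΓEdge n k a b) → (p : Star R origin t) →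
                      Terminal n k t → IsPositivePath n k (vertices p)
Star⇒IsPositivePath R⇒Γ p t-term =
  _ , t-term , path , λ ws ws-path → IsPath-shortest proj₁ (vertices p) ws path ws-path
  where path = Star⇒IsPath R⇒Γ p

0∈partialSums : ∀ k → 0 ∈ partialSums k
0∈partialSums []      = here refl
0∈partialSums (_ ∷ _) = here refl

sum∈partialSums : ∀ k → sum k ∈ partialSums k
sum∈partialSums = go 0
  where
  go : ∀ a k → a + sum k ∈ scanl _+_ a k
  go a []       = here (ℕₚ.+-identityʳ a)
  go a (m ∷ ms) =
    there (subst (_∈ scanl _+_ (a + m) ms) (ℕₚ.+-assoc a m (sum ms)) (go (a + m) ms))

+-suc≡⇒< : ∀ {m d n} → m + suc d ≡ n → m < n
+-suc≡⇒< {m} {d} eq = ℕₚ.≤-trans (ℕₚ.m≤m+n (suc m) d) (ℕₚ.≤-reflexive (trans (sym (ℕₚ.+-suc m d)) eq))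

+-suc-shift : ∀ a b d → a + suc b + d ≡ a + b + suc d
+-suc-shift a b d = trans (cong (_+ d) (ℕₚ.+-suc a b)) (sym (ℕₚ.+-suc (a + b) d))

module PositivePaths (K : OrderedField) (n : ℕ) (k : List ℕ) (k-sum : sum k ≡ n)
  (lam : ℕ → OrderedField.Carrier K) (shape : GT.LambdaShape K n k lam) (c : GT.Point K) where
  open OrderedField K using (isTotalOrder) renaming (_≤_ to _≤ᴷ_; _<_ to _<ᴷ_)
  open IsTotalOrder isTotalOrder using (antisym) renaming (reflexive to ≤ᴷ-reflexive)
  open OrderedFieldProperties K using (poset; ≤-≤-split)
  open PosetReasoning poset
  open GT K

  breakpoint-or-constant : ∀ e a → 1 ≤ a → a + e < n →
    (Σ ℕ λ m → m ∈ partialSums k × a ≤ m × m ≤ a + e) ⊎ lam a ≡ lam (suc (a + e))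
  breakpoint-or-constant e a 1≤a a+e<n with a ∈? partialSums k
  ... | yes a∈ = inj₁ (a , a∈ , ℕₚ.≤-refl , ℕₚ.m≤m+n a e)
  breakpoint-or-constant zero a 1≤a a<n | no a∉ =
    inj₂ (trans (proj₂ shape a 1≤a (subst (_< n) (ℕₚ.+-identityʳ a) a<n) a∉)
                (cong (λ m → lam (suc m)) (sym (ℕₚ.+-identityʳ a))))
  breakpoint-or-constant (suc e) a 1≤a a+e<n | no a∉
    with breakpoint-or-constant e (suc a) (s≤s z≤n) (subst (_< n) (ℕₚ.+-suc a e) a+e<n)
  ... | inj₁ (m , m∈ , a<m , m≤) =
    inj₁ (m , m∈ , ℕₚ.<⇒≤ a<m , subst (m ≤_) (sym (ℕₚ.+-suc a e)) m≤)
  ... | inj₂ eq =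
    inj₂ (trans (proj₂ shape a 1≤a a<n a∉) (trans eq (cong (λ m → lam (suc m)) (sym (ℕₚ.+-suc a e)))))
    where
    a<n : a < n
    a<n = ℕₚ.≤-<-trans (ℕₚ.m≤m+n a (suc e)) a+e<n

  ext-inside : ∀ y i j → i + j ≤ n → ext n lam y i j ≡ y i j
  ext-inside y i j i+j≤n with (i + j) ≟ suc n
  ... | yes eq = ⊥-elim (ℕₚ.<-irrefl refl (subst (_≤ n) eq i+j≤n))
  ... | no _   = refl

  ext-boundary : ∀ y i j → i + j ≡ suc n → ext n lam y i j ≡ lam i
  ext-boundary y i j eq with (i + j) ≟ suc n
  ... | yes _  = refl
  ... | no neq = ⊥-elim (neq eq)

  Arrow : Vertex → Vertex → Set
  Arrow u v = ΓEdge n k u v × PhiEdge n lam c u v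

  ToTerminal : Vertex → Set
  ToTerminal v = Σ Vertex λ t → Terminal n k t × Star Arrow v t

  _◅ᵗ_ : ∀ {u v} → Arrow u v → ToTerminal v → ToTerminal u
  g ◅ᵗ (t , t-term , q) = t , t-term , g ◅ q

  PositivePathThrough : Vertex → Vertex → Set
  PositivePathThrough u v =
    Σ (List Vertex) λ vs → IsPositivePath n k vs × ((u , v) ∈ steps vs) × LiesIn n lam c vs

  positive-path-through : ∀ {u v t} → Star Arrow origin u → Arrow u v → Star Arrow v t →
                          Terminal n k t → PositivePathThrough u v
  positive-path-through p g q t-term =
    vertices w , Star⇒IsPositivePath proj₁ w t-term , ∈-steps-◅◅ p g q ,
    (λ m → φ-incident (∈-vertices-◅◅⇒incident p g q m)) , (λ m → proj₂ (steps-vertices⁻ w m))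
    where
    w = p ◅◅ g ◅ q
    φ-incident : ∀ {z} → Incident {R = Arrow} z → PhiVertex n lam c z
    φ-incident (y , e) = y , Sum.map proj₂ proj₂ e

  module AtPoint (x : Point) (x∈F : InFace n lam c x) where
    X : Point
    X = ext n lam x

    Gap : Vertex → Set
    Gap (zero  , j)    = j ≤ n
    Gap (suc i , zero) = suc i ≤ n
    Gap (a@(suc _) , b@(suc _)) = a + b ≤ n × X (suc a) b <ᴷ X a (suc b)

    Rise Drop : ℕ → ℕ → Set
    Rise i j = x i j <ᴷ X i (suc j)
    Drop i j = X (suc i) j <ᴷ x i j

    inside : ∀ {i j} → InI n i j → X i j ≡ x i j
    inside {i} {j} (_ , _ , i+j≤n) = ext-inside x i j i+j≤n

    row-mono : ∀ {i j} → InI n i j → X i j ≤ᴷ X i (suc j)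
    row-mono {i} {j} ij = subst (_≤ᴷ X i (suc j)) (sym (inside ij)) (proj₁ (proj₁ x∈F i j ij))

    col-mono : ∀ {i j} → InI n i j → X (suc i) j ≤ᴷ X i j
    col-mono {i} {j} ij = subst (X (suc i) j ≤ᴷ_) (sym (inside ij)) (proj₂ (proj₁ x∈F i j ij))

    row-to-boundary : ∀ d {i j} → 1 ≤ i → 1 ≤ j → i + j + d ≡ suc n → X i j ≤ᴷ lam i
    row-to-boundary zero {i} {j} _ _ eq =
      ≤ᴷ-reflexive (ext-boundary x i j (trans (sym (ℕₚ.+-identityʳ (i + j))) eq))
    row-to-boundary (suc d) {i} {j} 1≤i 1≤j eq = begin
      X i j       ≤⟨ row-mono (1≤i , 1≤j , ℕₚ.≤-pred (+-suc≡⇒< eq)) ⟩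
      X i (suc j) ≤⟨ row-to-boundary d 1≤i (s≤s z≤n) (trans (+-suc-shift i j d) eq) ⟩
      lam i       ∎

    col-to-boundary : ∀ d {i j} → 1 ≤ i → 1 ≤ j → i + j + d ≡ suc n → lam (i + d) ≤ᴷ X i j
    col-to-boundary zero {i} {j} _ _ eq = begin
      lam (i + 0) ≡⟨ cong lam (ℕₚ.+-identityʳ i) ⟩
      lam i       ≡⟨ ext-boundary x i j (trans (sym (ℕₚ.+-identityʳ (i + j))) eq) ⟨
      X i j       ∎
    col-to-boundary (suc d) {i} {j} 1≤i 1≤j eq = begin
      lam (i + suc d) ≡⟨ cong lam (ℕₚ.+-suc i d) ⟩
      lam (suc i + d) ≤⟨ col-to-boundary d (s≤s z≤n) 1≤j (trans (sym (ℕₚ.+-suc (i + j) d)) eq) ⟩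
      X (suc i) j     ≤⟨ col-mono (1≤i , 1≤j , ℕₚ.≤-pred (+-suc≡⇒< eq)) ⟩
      X i j           ∎

    gap⇒breakpoint : ∀ {a b} → Gap (a , b) → Σ ℕ λ m → m ∈ partialSums k × a ≤ m × m + b ≤ n
    gap⇒breakpoint {zero}  {j}    j≤n = 0 , 0∈partialSums k , z≤n , j≤n
    gap⇒breakpoint {suc i} {zero} i<n =
      n , subst (_∈ partialSums k) k-sum (sum∈partialSums k) , i<n , ℕₚ.≤-reflexive (ℕₚ.+-identityʳ n)
    gap⇒breakpoint {a@(suc _)} {b@(suc _)} (a+b≤n , gap) with ℕₚ.m≤n⇒∃[o]m+o≡n a+b≤n
    ... | e , a+b+e≡n with breakpoint-or-constant e a (s≤s z≤n) a+e<n
      where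
      a+e<n : a + e < n
      a+e<n = subst (a + e <_) a+b+e≡n (ℕₚ.+-monoˡ-< e (ℕₚ.m<m+n a (s≤s z≤n)))
    ... | inj₁ (m , m∈ , a≤m , m≤a+e) =
      m , m∈ , a≤m ,
      ℕₚ.≤-trans (ℕₚ.+-monoˡ-≤ b m≤a+e) (ℕₚ.≤-reflexive (trans (xy∙z≈xz∙y a e b) a+b+e≡n))
    ... | inj₂ λa≡λ = ⊥-elim (proj₂ gap (antisym (proj₁ gap) (begin
      X a (suc b)       ≤⟨ row-to-boundary e (s≤s z≤n) (s≤s z≤n)
                             (trans (cong (_+ e) (ℕₚ.+-suc a b)) (cong suc a+b+e≡n)) ⟩
      lam a             ≡⟨ λa≡λ ⟩
      lam (suc (a + e)) ≤⟨ col-to-boundary e (s≤s z≤n) (s≤s z≤n) (cong suc a+b+e≡n) ⟩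
      X (suc a) b       ∎)))

    gap⇒ΓVertex : ∀ {v} → Gap v → ΓVertex n k v
    gap⇒ΓVertex {a , b} g with gap⇒breakpoint g
    ... | m , m∈ , a≤m , m+b≤n =
      (m , n ∸ m) , (m , m∈ , refl , refl) , a≤m ,
      ℕₚ.m+n≤o⇒m≤o∸n b (subst (_≤ n) (ℕₚ.+-comm m b) m+b≤n)

    gap⇒terminal : ∀ {a b} → Gap (a , b) → a + b ≡ n → Terminal n k (a , b)
    gap⇒terminal {a} {b} g a+b≡n with gap⇒breakpoint g
    ... | m , m∈ , a≤m , m+b≤n =
      m , m∈ , a≡m , sym (trans (cong₂ _∸_ (sym a+b≡n) (sym a≡m)) (ℕₚ.m+n∸m≡n a b))
      where
      a≡m : a ≡ m
      a≡m = ℕₚ.≤-antisym a≤m (ℕₚ.+-cancelʳ-≤ b m a (subst (m + b ≤_) (sym a+b≡n) m+b≤n))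

    gap⇒rank≤n : ∀ {a b} → Gap (a , b) → a + b ≤ n
    gap⇒rank≤n {a} {b} g with gap⇒breakpoint g
    ... | _ , _ , a≤m , m+b≤n = ℕₚ.≤-trans (ℕₚ.+-monoˡ-≤ b a≤m) m+b≤n

    gap-axisⁱ : ∀ {i} → i ≤ n → Gap (i , 0)
    gap-axisⁱ {zero}  _   = z≤n
    gap-axisⁱ {suc i} i<n = i<n

    rise⇒gap : ∀ {i j} (ij : InI n i j) → Rise i j → Gap (i , j)
    rise⇒gap {i} {j} ij@(s≤s z≤n , s≤s z≤n , i+j≤n) r = i+j≤n , (begin-strict
      X (suc i) j ≤⟨ col-mono ij ⟩
      X i j       ≡⟨ inside ij ⟩
      x i j       <⟨ r ⟩
      X i (suc j) ∎)

    drop⇒gap : ∀ {i j} (ij : InI n i j) → Drop i j → Gap (i , j)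
    drop⇒gap {i} {j} ij@(s≤s z≤n , s≤s z≤n , i+j≤n) d = i+j≤n , (begin-strict
      X (suc i) j <⟨ d ⟩
      x i j       ≡⟨ inside ij ⟨
      X i j       ≤⟨ row-mono ij ⟩
      X i (suc j) ∎)

    rise⇒gap-pred : ∀ {i j} (ij : InI n i j) → Rise i j → Gap (i ∸ 1 , j)
    rise⇒gap-pred {suc zero} (_ , _ , i+j≤n) _ = ℕₚ.≤-pred (ℕₚ.m≤n⇒m≤1+n i+j≤n)
    rise⇒gap-pred {suc (suc i)} {suc j} ij@(_ , _ , i+j≤n) r =
      ℕₚ.≤-pred (ℕₚ.m≤n⇒m≤1+n i+j≤n) , (begin-strict
      X (suc (suc i)) (suc j)       ≡⟨ inside ij ⟩
      x (suc (suc i)) (suc j)       <⟨ r ⟩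
      X (suc (suc i)) (suc (suc j)) ≤⟨ col-mono above-left ⟩
      X (suc i) (suc (suc j))       ∎)
      where
      above-left : InI n (suc i) (suc (suc j))
      above-left = s≤s z≤n , s≤s z≤n , subst (_≤ n) (sym (ℕₚ.+-suc (suc i) (suc j))) i+j≤n

    drop⇒gap-pred : ∀ {i j} (ij : InI n i j) → Drop i j → Gap (i , j ∸ 1)
    drop⇒gap-pred {suc i} {suc zero} (_ , _ , i+j≤n) _ = ℕₚ.≤-trans (ℕₚ.m≤m+n (suc i) 1) i+j≤n
    drop⇒gap-pred {suc i} {suc (suc j)} ij@(_ , _ , i+j≤n) d =
      ℕₚ.≤-trans (ℕₚ.+-monoʳ-≤ (suc i) (ℕₚ.n≤1+n (suc j))) i+j≤n , (begin-strict
      X (suc (suc i)) (suc j)       ≤⟨ row-mono below-left ⟩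
      X (suc (suc i)) (suc (suc j)) <⟨ d ⟩
      x (suc i) (suc (suc j))       ≡⟨ inside ij ⟨
      X (suc i) (suc (suc j))       ∎)
      where
      below-left : InI n (suc (suc i)) (suc j)
      below-left = s≤s z≤n , s≤s z≤n , subst (_≤ n) (ℕₚ.+-suc (suc i) (suc j)) i+j≤n

    gap⇒rise⊎drop : ∀ {i j} (ij : InI n i j) → Gap (i , j) → Rise i j ⊎ Drop i j
    gap⇒rise⊎drop {i} {j} ij@(s≤s z≤n , s≤s z≤n , _) (_ , gap) =
      [ (λ d → inj₂ (subst (X (suc i) j <ᴷ_) (inside ij) d))
      , (λ r → inj₁ (subst (_<ᴷ X i (suc j)) (inside ij) r)) ]′
        (≤-≤-split (col-mono ij) (row-mono ij) gap)

    gap⇒rise⊎drop-next : ∀ {a b} → 1 ≤ a → 1 ≤ b → a + b < n → X (suc a) b <ᴷ X a (suc b) →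
                         Rise (suc a) b ⊎ Drop a (suc b)
    gap⇒rise⊎drop-next {a} {b} 1≤a 1≤b a+b<n gap =
      [ (λ r → inj₁ (subst (_<ᴷ X (suc a) (suc b)) (inside below) r))
      , (λ d → inj₂ (subst (X (suc a) (suc b) <ᴷ_) (inside right) d)) ]′
        (≤-≤-split (row-mono below) (col-mono right) gap)
      where
      below : InI n (suc a) b
      below = s≤s z≤n , 1≤b , a+b<n
      right : InI n a (suc b)
      right = 1≤a , s≤s z≤n , subst (_≤ n) (sym (ℕₚ.+-suc a b)) a+b<n

    arrow : ∀ {u v} → Gap u → Gap v → QEdge u v → PhiEdge n lam c u v → Arrow u v
    arrow gu gv q e = (q , gap⇒ΓVertex gu , gap⇒ΓVertex gv) , e

    axisʲ-arrow : ∀ {j} → j < n → Arrow (0 , j) (0 , suc j)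
    axisʲ-arrow {j} j<n =
      arrow (ℕₚ.<⇒≤ j<n) j<n (inj₁ (refl , refl)) (inj₁ (j , j<n , refl , refl))

    axisⁱ-arrow : ∀ {i} → i < n → Arrow (i , 0) (suc i , 0)
    axisⁱ-arrow {i} i<n =
      arrow (gap-axisⁱ (ℕₚ.<⇒≤ i<n)) i<n (inj₂ (refl , refl)) (inj₂ (inj₁ (i , i<n , refl , refl)))

    rise-arrow : ∀ {i j} (ij : InI n i j) → Rise i j → Arrow (i ∸ 1 , j) (i , j)
    rise-arrow ij@(s≤s z≤n , _ , _) r =
      arrow (rise⇒gap-pred ij r) (rise⇒gap ij r) (inj₂ (refl , refl))
        (inj₂ (inj₂ (inj₁ (_ , _ , ij , refl , refl , x , x∈F , r))))

    drop-arrow : ∀ {i j} (ij : InI n i j) → Drop i j → Arrow (i , j ∸ 1) (i , j)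
    drop-arrow ij@(_ , s≤s z≤n , _) d =
      arrow (drop⇒gap-pred ij d) (drop⇒gap ij d) (inj₁ (refl , refl))
        (inj₂ (inj₂ (inj₂ (_ , _ , ij , refl , refl , x , x∈F , d))))

    walk-from-origin : ∀ {v} → Gap v → Star Arrow origin v
    walk-from-origin {zero  , zero}  _   = ε
    walk-from-origin {zero  , suc j} j<n =
      walk-from-origin {0 , j} (ℕₚ.<⇒≤ j<n) ◅◅ axisʲ-arrow j<n ◅ ε
    walk-from-origin {suc i , zero}  i<n =
      walk-from-origin {i , 0} (gap-axisⁱ (ℕₚ.<⇒≤ i<n)) ◅◅ axisⁱ-arrow i<n ◅ ε
    walk-from-origin {suc i , suc j} g@(i+j≤n , _) =
      [ (λ r → walk-from-origin {i , suc j} (rise⇒gap-pred ij r) ◅◅ rise-arrow ij r ◅ ε)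
      , (λ d → walk-from-origin {suc i , j} (drop⇒gap-pred ij d) ◅◅ drop-arrow ij d ◅ ε)
      ]′ (gap⇒rise⊎drop ij g)
      where
      ij : InI n (suc i) (suc j)
      ij = s≤s z≤n , s≤s z≤n , i+j≤n

    walk-to-terminal : ∀ d {a b} → a + b + d ≡ n → Gap (a , b) → ToTerminal (a , b)
    walk-to-terminal zero {a} {b} eq g =
      (a , b) , gap⇒terminal g (trans (sym (ℕₚ.+-identityʳ (a + b))) eq) , ε
    walk-to-terminal (suc d) {zero} {j} eq _ =
      axisʲ-arrow (+-suc≡⇒< eq) ◅ᵗ walk-to-terminal d (trans (+-suc-shift 0 j d) eq) (+-suc≡⇒< eq)
    walk-to-terminal (suc d) {suc i} {zero} eq _ =
      axisⁱ-arrow i<n ◅ᵗ walk-to-terminal d (trans (sym (ℕₚ.+-suc (suc i + 0) d)) eq) i<n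
      where
      i<n : suc i < n
      i<n = subst (_< n) (ℕₚ.+-identityʳ (suc i)) (+-suc≡⇒< eq)
    walk-to-terminal (suc d) {a@(suc _)} {b@(suc _)} eq (_ , gap) =
      [ (λ r → rise-arrow below r ◅ᵗ
                 walk-to-terminal d (trans (sym (ℕₚ.+-suc (a + b) d)) eq) (rise⇒gap below r))
      , (λ dr → drop-arrow right dr ◅ᵗ
                 walk-to-terminal d (trans (+-suc-shift a b d) eq) (drop⇒gap right dr))
      ]′ (gap⇒rise⊎drop-next (s≤s z≤n) (s≤s z≤n) a+b<n gap)
      where
      a+b<n : a + b < n
      a+b<n = +-suc≡⇒< eq
      below : InI n (suc a) b
      below = s≤s z≤n , s≤s z≤n , a+b<n
      right : InI n a (suc b)
      right = s≤s z≤n , s≤s z≤n , subst (_≤ n) (sym (ℕₚ.+-suc a b)) a+b<n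

    extend : ∀ {u v} → Gap u → Gap v → Arrow u v → PositivePathThrough u v
    extend {v = _ , _} gu gv g with ℕₚ.m≤n⇒∃[o]m+o≡n (gap⇒rank≤n gv)
    ... | d , eq with walk-to-terminal d eq gv
    ... | t , t-term , q = positive-path-through (walk-from-origin gu) g q t-term

lemma2p3 : (K : OrderedField) (n : ℕ) → 1 < n →
    (k : List ℕ) → All (λ m → 0 < m) k → sum k ≡ n →
    (lam : ℕ → OrderedField.Carrier K) → GT.LambdaShape K n k lam →
    (c : GT.Point K) → Σ (GT.Point K) (λ x → GT.InFace K n lam c x) →
    (u v : Vertex) → GT.PhiEdge K n lam c u v →
    Σ (List Vertex) (λ vs → IsPositivePath n k vs × ((u , v) ∈ steps vs) × GT.LiesIn K n lam c vs)
lemma2p3 K n _ k _ k-sum lam shape c (x₀ , x₀∈F) u v = through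
  where
  open PositivePaths K n k k-sum lam shape c
  through : GT.PhiEdge K n lam c u v → PositivePathThrough u v
  through (inj₁ (j , j<n , refl , refl)) =
    let open AtPoint x₀ x₀∈F in extend (ℕₚ.<⇒≤ j<n) j<n (axisʲ-arrow j<n)
  through (inj₂ (inj₁ (i , i<n , refl , refl))) =
    let open AtPoint x₀ x₀∈F in extend (gap-axisⁱ (ℕₚ.<⇒≤ i<n)) (gap-axisⁱ i<n) (axisⁱ-arrow i<n)
  through (inj₂ (inj₂ (inj₁ (_ , _ , ij , refl , refl , x , x∈F , r)))) =
    let open AtPoint x x∈F in extend (rise⇒gap-pred ij r) (rise⇒gap ij r) (rise-arrow ij r)
  through (inj₂ (inj₂ (inj₂ (_ , _ , ij , refl , refl , x , x∈F , d)))) =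
    let open AtPoint x x∈F in extend (drop⇒gap-pred ij d) (drop⇒gap ij d) (drop-arrow ij d)
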